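{- Let $t\ge3$ be an integer. Every $t$-mansion is $(2P_3,C_4,C_6,C_7,T_0)$-free and contains an induced $t$-pentagon. Moreover, every $t$-mansion is anticonnected and contains no simplicial and no universal vertices.
   Context: All graphs are finite, simple and nonnull. $G$ is $H$-free if no induced subgraph is isomorphic to $H$. $C_k$: cycle on $k$ vertices; $2P_3$: disjoint union of two 3-vertex paths. $T_0$ is the graph with vertex set $\{p,p',q_0,q_1,q_2,q_3,r_1,r_2,r_3\}$ and exactly the edges $pp',pq_0,pq_2,pq_3,p'q_1,p'q_2,p'q_3,q_0r_1,q_1r_1,q_2r_2,q_3r_3,r_1r_2,r_1r_3,r_2r_3$. The $t$-pentagon has vertices $a,b_1,\dots,b_t,c_1,\dots,c_t$, with $a$ adjacent to all $b_i$ and no $c_i$, the $b_i$ pairwise nonadjacent, the $c_i$ pairwise adjacent, and $b_ic_j$ an edge iff $i=j$. Clique: possibly empty set of pairwise adjacent vertices; simplicial vertex: neighborhood is a clique; universal vertex: adjacent to all others; anticonnected: complement is connected. Complete/anticomplete: every vertex of one set adjacent/nonadjacent to every vertex of the other. $t$-villa: a graph whose vertex set is partitioned into nonempty cliques $A,B_1,\dots,B_t,C_1,\dots,C_t$ with $A$ complete to $\bigcup B_i$ and anticomplete to $\bigcup C_i$; $B_i$'s pairwise anticomplete; $C_i$'s pairwise complete; $B_i$ anticomplete to $C_j$ ($i\ne j$); each $B_i$ ordered $b^i_1,\dots,b^i_{r_i}$ with $\emptyset\ne N(b^i_{r_i})\cap C_i\subseteq\dots\subseteq N(b^i_1)\cap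 C_i=C_i$; $(A;B_1,\dots,B_t;C_1,\dots,C_t)$ is then a $t$-villa partition. $t$-mansion: a graph $Q$ whose vertex set is partitioned into cliques $A,B_1,\dots,B_t,C_1,\dots,C_t,F,X,Y$, with $A,B_i,C_i,F$ nonempty ($X,Y$ possibly empty), such that $Q\setminus(F\cup X\cup Y)$ is a $t$-villa with $t$-villa partition $(A;B_1,\dots,B_t;C_1,\dots,C_t)$; there is $j^*\in\{1,\dots,t\}$ such that $F$ is complete to $A$, to $\bigcup B_i\setminus B_{j^*}$ and to $\bigcup C_i\setminus C_{j^*}$, and anticomplete to $B_{j^*}\cup C_{j^*}$; $B_{j^*}$ is complete to $C_{j^*}$; $X$ is complete to $A\cup B_{j^*}$ and anticomplete to $\bigcup B_i\setminus B_{j^*}$ and to $\bigcup C_i$; $F$ is complete to $X\cup Y$; $X$ is anticomplete to $Y$; $Y$ is complete to $\bigcup C_i$ and anticomplete to $A\cup\bigcup B_i$. -}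

module Defs where

open import Data.Nat using (ℕ; zero; suc; _≤_; _≡ᵇ_; _%_; NonZero)
open import Data.Fin using (Fin; toℕ; fromℕ<; _≟_; #_)
open import Data.Bool using (Bool; true; false; _∧_; _∨_; not)
open import Data.Bool.Properties using (∨-comm; ∧-zeroʳ)
open import Data.List using (List; []; _∷_)
open import Data.Bool.ListAction using (any)
open import Data.Product using (Σ; _×_; _,_; ∃; ∃-syntax)
open import Data.Unit using (⊤; tt)
open import Relation.Nullary using (¬_; yes; no)
open import Relation.Nullary.Decidable using (⌊_⌋)
open import Relation.Binary.PropositionalEquality using (_≡_; _≢_; refl; sym; cong)
open import Relation.Binary.Definitions using (DecidableEquality)
open import Relation.Binary.Construct.Closure.ReflexiveTransitive using (Star)
open import Function.Definitions using (Injective)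

record SimpleGraph (V : Set) : Set where
  field
    adj        : V → V → Bool
    adj-sym    : ∀ u v → adj u v ≡ adj v u
    adj-irrefl : ∀ v → adj v v ≡ false
open SimpleGraph public

Adj : ∀ {V} → SimpleGraph V → V → V → Set
Adj G u v = adj G u v ≡ true

NonAdj : ∀ {V} → SimpleGraph V → V → V → Set
NonAdj G u v = adj G u v ≡ false

ContainsInduced : ∀ {W V} → SimpleGraph W → SimpleGraph V → Set
ContainsInduced {W} {V} H G =
  Σ (W → V) λ f → Injective _≡_ _≡_ f × (∀ u v → adj H u v ≡ adj G (f u) (f v))

Free : ∀ {W V} → SimpleGraph W → SimpleGraph V → Set
Free H G = ¬ ContainsInduced H G

private
  ≟-sym : ∀ {V : Set} (_≟V_ : DecidableEquality V) (u v : V) →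
          ⌊ u ≟V v ⌋ ≡ ⌊ v ≟V u ⌋
  ≟-sym _≟V_ u v with u ≟V v | v ≟V u
  ... | yes _ | yes _ = refl
  ... | no _  | no _  = refl
  ... | yes p | no q  = Data.Empty.⊥-elim (q (sym p))
    where import Data.Empty
  ... | no p  | yes q = Data.Empty.⊥-elim (p (sym q))
    where import Data.Empty

  ≟-refl : ∀ {V : Set} (_≟V_ : DecidableEquality V) (v : V) → ⌊ v ≟V v ⌋ ≡ true
  ≟-refl _≟V_ v with v ≟V v
  ... | yes _ = refl
  ... | no p  = Data.Empty.⊥-elim (p refl)
    where import Data.Empty

fromEdges : ∀ {V : Set} → DecidableEquality V → (V → V → Bool) → SimpleGraph V
fromEdges {V} _≟V_ e = record
  { adj = a ; adj-sym = s ; adj-irrefl = i }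
  where
  a : V → V → Bool
  a u v = (e u v ∨ e v u) ∧ not ⌊ u ≟V v ⌋
  s : ∀ u v → a u v ≡ a v u
  s u v rewrite ∨-comm (e u v) (e v u) | ≟-sym _≟V_ u v = refl
  i : ∀ v → a v v ≡ false
  i v rewrite ≟-refl _≟V_ v = ∧-zeroʳ (e v v ∨ e v v)

edgeList : ∀ {k} → List (Fin k × Fin k) → SimpleGraph (Fin k)
edgeList {k} es = fromEdges _≟_ λ u v → any (λ { (x , y) → ⌊ x ≟ u ⌋ ∧ ⌊ y ≟ v ⌋ }) es

-- C_k : vertices 0..k-1, i ~ j iff j ≡ i+1 (mod k) or i ≡ j+1 (mod k)
-- (edges i,i+1 for i+1 < k, and the edge k-1,0)
cycle : (k : ℕ) → SimpleGraph (Fin k)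
cycle k = fromEdges _≟_ λ i j →
  (toℕ j ≡ᵇ suc (toℕ i)) ∨ ((suc (toℕ i) ≡ᵇ k) ∧ (toℕ j ≡ᵇ 0))

twoP3 : SimpleGraph (Fin 6)
twoP3 = edgeList ((# 0 , # 1) ∷ (# 1 , # 2) ∷ (# 3 , # 4) ∷ (# 4 , # 5) ∷ [])

-- T_0 with p=0, p'=1, q0=2, q1=3, q2=4, q3=5, r1=6, r2=7, r3=8
T0 : SimpleGraph (Fin 9)
T0 = edgeList
  ( (# 0 , # 1) ∷ (# 0 , # 2) ∷ (# 0 , # 4) ∷ (# 0 , # 5)
  ∷ (# 1 , # 3) ∷ (# 1 , # 4) ∷ (# 1 , # 5)
  ∷ (# 2 , # 6) ∷ (# 3 , # 6) ∷ (# 4 , # 7) ∷ (# 5 , # 8)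
  ∷ (# 6 , # 7) ∷ (# 6 , # 8) ∷ (# 7 , # 8) ∷ [])

data PentV (t : ℕ) : Set where
  pa : PentV t
  pb : Fin t → PentV t
  pc : Fin t → PentV t

pentV-≟ : ∀ {t} → DecidableEquality (PentV t)
pentV-≟ pa pa = yes refl
pentV-≟ pa (pb _) = no λ ()
pentV-≟ pa (pc _) = no λ ()
pentV-≟ (pb _) pa = no λ ()
pentV-≟ (pb i) (pb j) with i ≟ j
... | yes refl = yes refl
... | no p = no λ { refl → p refl }
pentV-≟ (pb _) (pc _) = no λ ()
pentV-≟ (pc _) pa = no λ ()
pentV-≟ (pc _) (pb _) = no λ ()
pentV-≟ (pc i) (pc j) with i ≟ j
... | yes refl = yes refl
... | no p = no λ { refl → p refl }

pentEdge : ∀ {t} → PentV t → PentV t → Bool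
pentEdge pa (pb _) = true
pentEdge (pb i) (pc j) = ⌊ i ≟ j ⌋
pentEdge (pc _) (pc _) = true
pentEdge _ _ = false

pentagon : (t : ℕ) → SimpleGraph (PentV t)
pentagon t = fromEdges pentV-≟ pentEdge

complement : ∀ {V} → DecidableEquality V → SimpleGraph V → SimpleGraph V
complement _≟V_ G = fromEdges _≟V_ λ u v → not (adj G u v)

Connected : ∀ {V} → SimpleGraph V → Set
Connected G = ∀ u v → Star (Adj G) u v

Anticonnected : ∀ {n} → SimpleGraph (Fin n) → Set
Anticonnected G = Connected (complement _≟_ G)

Simplicial : ∀ {V} → SimpleGraph V → V → Set
Simplicial G v = ∀ u w → Adj G v u → Adj G v w → u ≢ w → Adj G u w

Universal : ∀ {V} → SimpleGraph V → V → Set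
Universal G v = ∀ u → u ≢ v → Adj G u v

data Part (t : ℕ) : Set where
  pA pF pX pY : Part t
  pB pC : Fin t → Part t

record IsMansion (t : ℕ) {n : ℕ} (G : SimpleGraph (Fin n)) : Set where
  field
    part  : Fin n → Part t
    jstar : Fin t
    clique : ∀ u v → u ≢ v → part u ≡ part v → Adj G u v
    A-ne : ∃[ v ] part v ≡ pA
    B-ne : ∀ i → ∃[ v ] part v ≡ pB i
    C-ne : ∀ i → ∃[ v ] part v ≡ pC i
    F-ne : ∃[ v ] part v ≡ pF
    -- t-villa conditions on A, B_i, C_i
    A-B : ∀ u v i → part u ≡ pA → part v ≡ pB i → Adj G u v
    A-C : ∀ u v i → part u ≡ pA → part v ≡ pC i → NonAdj G u v
    B-B : ∀ u v i j → i ≢ j → part u ≡ pB i → part v ≡ pB j → NonAdj G u v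
    C-C : ∀ u v i j → i ≢ j → part u ≡ pC i → part v ≡ pC j → Adj G u v
    B-C : ∀ u v i j → i ≢ j → part u ≡ pB i → part v ≡ pC j → NonAdj G u v
    -- each B_i is ordered b_0,...,b_r (r+1 = |B_i|) with
    -- ∅ ≠ N(b_r) ∩ C_i ⊆ ... ⊆ N(b_0) ∩ C_i = C_i
    B-order : ∀ i → Σ ℕ λ r → Σ (Fin (suc r) → Fin n) λ b →
        Injective _≡_ _≡_ b
      × (∀ k → part (b k) ≡ pB i)
      × (∀ v → part v ≡ pB i → ∃[ k ] b k ≡ v)
      × (∀ c → part c ≡ pC i → Adj G (b Data.Fin.zero) c)
      × (∃[ c ] (part c ≡ pC i × Adj G (b (Data.Fin.fromℕ r)) c))
      × (∀ k l → toℕ k ≤ toℕ l → ∀ c → part c ≡ pC i → Adj G (b l) c → Adj G (b k) c)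
    F-A : ∀ u v → part u ≡ pF → part v ≡ pA → Adj G u v
    F-B : ∀ u v i → i ≢ jstar → part u ≡ pF → part v ≡ pB i → Adj G u v
    F-C : ∀ u v i → i ≢ jstar → part u ≡ pF → part v ≡ pC i → Adj G u v
    F-Bj : ∀ u v → part u ≡ pF → part v ≡ pB jstar → NonAdj G u v
    F-Cj : ∀ u v → part u ≡ pF → part v ≡ pC jstar → NonAdj G u v
    Bj-Cj : ∀ u v → part u ≡ pB jstar → part v ≡ pC jstar → Adj G u v
    X-A : ∀ u v → part u ≡ pX → part v ≡ pA → Adj G u v
    X-Bj : ∀ u v → part u ≡ pX → part v ≡ pB jstar → Adj G u v
    X-B : ∀ u v i → i ≢ jstar → part u ≡ pX → part v ≡ pB i → NonAdj G u v
    X-C : ∀ u v i → part u ≡ pX → part v ≡ pC i → NonAdj G u v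
    F-X : ∀ u v → part u ≡ pF → part v ≡ pX → Adj G u v
    F-Y : ∀ u v → part u ≡ pF → part v ≡ pY → Adj G u v
    X-Y : ∀ u v → part u ≡ pX → part v ≡ pY → NonAdj G u v
    Y-C : ∀ u v i → part u ≡ pY → part v ≡ pC i → Adj G u v
    Y-A : ∀ u v → part u ≡ pY → part v ≡ pA → NonAdj G u v
    Y-B : ∀ u v i → part u ≡ pY → part v ≡ pB i → NonAdj G u v

{-# OPTIONS --safe #-}
module Submission where

-- Label every vertex of a mansion by its part, merging all B_i (resp. C_i) with i ≠ j* into one
-- label B (resp. C). For all pairs of labels except {B, B} and {B, C} the definition decides
-- adjacency. Beyond that only two facts are needed: a path b – v – b′ with b, b′ in ⋃ B_i and v in
-- ⋃ B_i ∪ ⋃ C_i has the chord bb′, since the B_i are cliques anticomplete to each other and to the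
-- C_j with j ≠ i; and a path c – b – b′ – c′ with b, b′ in ⋃ B_i and c, c′ in ⋃ C_i has one of the
-- chords cb′, bc′, since the neighbourhoods in C_i of the vertices of B_i are nested. An induced
-- copy of H in a mansion inherits a labelling obeying these local rules, and an exhaustive search
-- shows that 2P₃, C₄, C₆, C₇ and T₀ admit none.
--
-- A vertex of A, a vertex of each B_i complete to C_i and a vertex of each C_i induce the
-- t-pentagon. In the complement every vertex reaches a fixed vertex of A via C, which gives
-- anticonnectivity and hence excludes universal vertices.

open import Defs
open import Data.Nat using (ℕ; _≤_; s≤s)
open import Data.Nat.Properties using (<⇒≤; ≤-total)
open import Data.Fin using (Fin; zero; suc; toℕ; fromℕ; _≟_)
open import Data.Fin.Properties using (toℕ-fromℕ; toℕ≤pred[n])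
open import Data.Bool using (Bool; true; false; T; _∧_; _∨_; not)
import Data.Bool.Properties as Bool
open import Data.Bool.ListAction using (all; any)
open import Data.Maybe using (Maybe; just; nothing)
open import Data.List using (List; []; _∷_; map; allFin)
open import Data.List.Membership.Propositional using (_∈_; lose)
open import Data.List.Relation.Unary.Any using (here; there)
open import Data.List.Relation.Unary.All using ([]; _∷_; universal)
open import Data.List.Relation.Unary.All.Properties using (all⁻; map⁺)
open import Data.List.Relation.Unary.Any.Properties using (any⁺)
open import Data.List.Relation.Unary.AllPairs using ([]; _∷_)
open import Data.List.Relation.Unary.Unique.Propositional using (Unique)
import Data.List.Relation.Unary.Unique.Propositional.Properties as Unique
import Data.List.Relation.Unary.Unique.DecPropositional as DecUnique
open import Data.Product using (_×_; _,_; proj₁; proj₂; ∃; ∃-syntax)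
open import Data.Sum using (_⊎_; inj₁; inj₂)
open import Data.Unit using (tt)
open import Function using (_∘_)
open import Function.Bundles using (Equivalence)
open import Function.Definitions using (Injective)
open import Relation.Nullary using (¬_; yes; no; contradiction)
open import Relation.Nullary.Decidable using (⌊_⌋; fromWitness)
open import Relation.Binary.Definitions using (DecidableEquality)
open import Relation.Binary.PropositionalEquality using (_≡_; _≢_; refl; sym; trans; subst; cong; ≢-sym)
open import Relation.Binary.Construct.Closure.ReflexiveTransitive using (Star; ε; _◅_; _◅◅_; reverse)

open Equivalence using (from)

adj-flip : ∀ {V} (G : SimpleGraph V) {u v b} → adj G v u ≡ b → adj G u v ≡ b
adj-flip G {u} {v} = trans (adj-sym G u v)

Adj⇒¬NonAdj : ∀ {V} (G : SimpleGraph V) {u v} → Adj G u v → ¬ NonAdj G u v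
Adj⇒¬NonAdj _ adj≡true adj≡false with trans (sym adj≡true) adj≡false
... | ()

¬simplicial : ∀ {V} (G : SimpleGraph V) {v u w} →
              Adj G v u → Adj G v w → u ≢ w → NonAdj G u w → ¬ Simplicial G v
¬simplicial G vu vw u≢w uw simplicial = Adj⇒¬NonAdj G (simplicial _ _ vu vw u≢w) uw

complement-adj : ∀ {V} (_≟V_ : DecidableEquality V) (G : SimpleGraph V) {u v} →
                 NonAdj G u v → u ≢ v → Adj (complement _≟V_ G) u v
complement-adj _≟V_ G {u} {v} uv u≢v rewrite uv with u ≟V v
... | yes u≡v = contradiction u≡v u≢v
... | no _    = refl

complement-nonadj : ∀ {V} (_≟V_ : DecidableEquality V) (G : SimpleGraph V) {u v} →
                    Adj G u v → NonAdj (complement _≟V_ G) u v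
complement-nonadj _≟V_ G {u} {v} uv rewrite uv | adj-flip G {v} {u} uv = refl

connected-via : ∀ {V} (G : SimpleGraph V) (hub : V) → (∀ v → Star (Adj G) v hub) → Connected G
connected-via G hub path u v = path u ◅◅ reverse (adj-flip G) (path v)

anticonnected⇒¬universal : ∀ {V} (_≟V_ : DecidableEquality V) (G : SimpleGraph V) →
                           Connected (complement _≟V_ G) → ∀ {u v} → u ≢ v → ¬ Universal G v
anticonnected⇒¬universal _≟V_ G anti {u} {v} u≢v universal with anti v u
... | ε = u≢v refl
... | _◅_ {j = w} co-vw _ =
  Adj⇒¬NonAdj Ḡ co-vw (complement-nonadj _≟V_ G (adj-flip G (universal w w≢v)))
  where
  Ḡ : SimpleGraph _
  Ḡ = complement _≟V_ G
  w≢v : w ≢ v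
  w≢v refl = Adj⇒¬NonAdj Ḡ co-vw (adj-irrefl Ḡ v)

module LocalConstraints
  {L : Set} (labels : List L) (∈-labels : ∀ l → l ∈ labels)
  (ok₂ : L → L → Bool → Bool)
  (ok₃ : L → L → L → Bool → Bool → Bool → Bool)
  (ok₄ : L → L → L → L → Bool → Bool → Bool → Bool → Bool → Bool → Bool)
  where

  record Respects {V : Set} (G : SimpleGraph V) (ℓ : V → L) : Set where
    field
      pairs   : ∀ {u v} → Unique (u ∷ v ∷ []) → T (ok₂ (ℓ u) (ℓ v) (adj G u v))
      triples : ∀ {u v w} → Unique (u ∷ v ∷ w ∷ []) →
                T (ok₃ (ℓ u) (ℓ v) (ℓ w) (adj G u v) (adj G u w) (adj G v w))
      quads   : ∀ {u v w x} → Unique (u ∷ v ∷ w ∷ x ∷ []) →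
                T (ok₄ (ℓ u) (ℓ v) (ℓ w) (ℓ x)
                       (adj G u v) (adj G u w) (adj G u x) (adj G v w) (adj G v x) (adj G w x))

  restrict : ∀ {W V} {H : SimpleGraph W} {G : SimpleGraph V} {ℓ : V → L} →
             (H↪G : ContainsInduced H G) → Respects G ℓ → Respects H (ℓ ∘ proj₁ H↪G)
  restrict {H = H} {G} {ℓ} (f , f-inj , f-adj) R = record
    { pairs = pairs′ ; triples = triples′ ; quads = quads′ }
    where
    open Respects R
    pairs′ : ∀ {u v} → Unique (u ∷ v ∷ []) → T (ok₂ (ℓ (f u)) (ℓ (f v)) (adj H u v))
    pairs′ {u} {v} uq rewrite f-adj u v = pairs (Unique.map⁺ f-inj uq)
    triples′ : ∀ {u v w} → Unique (u ∷ v ∷ w ∷ []) →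
               T (ok₃ (ℓ (f u)) (ℓ (f v)) (ℓ (f w)) (adj H u v) (adj H u w) (adj H v w))
    triples′ {u} {v} {w} uq rewrite f-adj u v | f-adj u w | f-adj v w =
      triples (Unique.map⁺ f-inj uq)
    quads′ : ∀ {u v w x} → Unique (u ∷ v ∷ w ∷ x ∷ []) →
             T (ok₄ (ℓ (f u)) (ℓ (f v)) (ℓ (f w)) (ℓ (f x))
                    (adj H u v) (adj H u w) (adj H u x) (adj H v w) (adj H v x) (adj H w x))
    quads′ {u} {v} {w} {x} uq
      rewrite f-adj u v | f-adj u w | f-adj u x | f-adj v w | f-adj v x | f-adj w x =
      quads (Unique.map⁺ f-inj uq)

  module Search {k : ℕ} (H : SimpleGraph (Fin k)) where
    open DecUnique (_≟_ {k}) using (unique?)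

    Entry : Set
    Entry = Fin k × L

    unlessRepeated : List (Fin k) → Bool → Bool
    unlessRepeated vs b = b ∨ not ⌊ unique? vs ⌋

    check₂ : Entry → Entry → Bool
    check₂ (u , l) (v , m) = unlessRepeated (u ∷ v ∷ []) (ok₂ l m (adj H u v))

    check₃ : Entry → Entry → Entry → Bool
    check₃ (u , l) (v , m) (w , n) = unlessRepeated (u ∷ v ∷ w ∷ [])
      (ok₃ l m n (adj H u v) (adj H u w) (adj H v w))

    check₄ : Entry → Entry → Entry → Entry → Bool
    check₄ (u , l) (v , m) (w , n) (x , o) = unlessRepeated (u ∷ v ∷ w ∷ x ∷ [])
      (ok₄ l m n o (adj H u v) (adj H u w) (adj H u x) (adj H v w) (adj H v x) (adj H w x))

    fits : Entry → List Entry → Bool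
    fits e es =
      all (λ d → check₂ d e ∧ check₂ e d) es ∧
      all (λ d → all (λ d′ → check₃ e d d′ ∧ check₃ d e d′ ∧ check₃ d d′ e) es) es ∧
      all (λ d → all (λ d′ → all (λ d″ →
        check₄ e d d′ d″ ∧ check₄ d e d′ d″ ∧ check₄ d d′ e d″ ∧ check₄ d d′ d″ e) es) es) es

    extendable : List (Fin k) → List Entry → Bool
    extendable []       es = true
    extendable (v ∷ vs) es = any (λ l → fits (v , l) es ∧ extendable vs ((v , l) ∷ es)) labels

    labellable : Bool
    labellable = extendable (allFin k) []

    respects⇒labellable : ∀ {ℓ} → Respects H ℓ → T labellable
    respects⇒labellable {ℓ} R = extendable-labelled (allFin k) []
      where
      open Respects R

      labelled : Fin k → Entry
      labelled v = v , ℓ v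

      _&_ : ∀ {a b} → T a → T b → T (a ∧ b)
      p & q = from Bool.T-∧ (p , q)
      infixr 4 _&_

      unlessRepeated-intro : ∀ {b} vs → (Unique vs → T b) → T (unlessRepeated vs b)
      unlessRepeated-intro vs h with unique? vs
      ... | yes uq = from Bool.T-∨ (inj₁ (h uq))
      ... | no _   = from Bool.T-∨ (inj₂ tt)

      check₂-labelled : ∀ u v → T (check₂ (labelled u) (labelled v))
      check₂-labelled u v = unlessRepeated-intro (u ∷ v ∷ []) pairs

      check₃-labelled : ∀ u v w → T (check₃ (labelled u) (labelled v) (labelled w))
      check₃-labelled u v w = unlessRepeated-intro (u ∷ v ∷ w ∷ []) triples

      check₄-labelled : ∀ u v w x → T (check₄ (labelled u) (labelled v) (labelled w) (labelled x))
      check₄-labelled u v w x = unlessRepeated-intro (u ∷ v ∷ w ∷ x ∷ []) quads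

      all-labelled : ∀ {p : Entry → Bool} → (∀ v → T (p (labelled v))) →
                     ∀ vs → T (all p (map labelled vs))
      all-labelled h vs = all⁻ _ (map⁺ (universal h vs))

      fits-labelled : ∀ v vs → T (fits (labelled v) (map labelled vs))
      fits-labelled v vs =
        all-labelled (λ u → check₂-labelled u v & check₂-labelled v u) vs &
        all-labelled (λ u → all-labelled (λ w →
          check₃-labelled v u w & check₃-labelled u v w & check₃-labelled u w v) vs) vs &
        all-labelled (λ u → all-labelled (λ w → all-labelled (λ x →
          check₄-labelled v u w x & check₄-labelled u v w x &
          check₄-labelled u w v x & check₄-labelled u w x v) vs) vs) vs

      extendable-labelled : ∀ vs us → T (extendable vs (map labelled us))
      extendable-labelled []       us = tt
      extendable-labelled (v ∷ vs) us =
        any⁺ _ (lose (∈-labels (ℓ v)) (fits-labelled v us & extendable-labelled vs (v ∷ us)))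

  open Search using (labellable) public

  unlabellable⇒free : ∀ {V k} {G : SimpleGraph V} {ℓ : V → L} (H : SimpleGraph (Fin k)) →
                      Respects G ℓ → labellable H ≡ false → Free H G
  unlabellable⇒free H R unlabellable H↪G =
    subst T unlabellable (Search.respects⇒labellable H (restrict H↪G R))

-- B⋆ and C⋆ label B_{j*} and C_{j*}; B and C label all other B_i and C_i.
data Lab : Set where
  A F X Y B⋆ C⋆ B C : Lab

labels : List Lab
labels = A ∷ F ∷ X ∷ Y ∷ B⋆ ∷ C⋆ ∷ B ∷ C ∷ []

∈-labels : ∀ l → l ∈ labels
∈-labels A  = here refl
∈-labels F  = there (here refl)
∈-labels X  = there (there (here refl))
∈-labels Y  = there (there (there (here refl)))
∈-labels B⋆ = there (there (there (there (here refl))))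
∈-labels C⋆ = there (there (there (there (there (here refl)))))
∈-labels B  = there (there (there (there (there (there (here refl))))))
∈-labels C  = there (there (there (there (there (there (there (here refl)))))))

_~_ : Lab → Lab → Bool
A  ~ A  = true
A  ~ F  = true
A  ~ X  = true
A  ~ B⋆ = true
A  ~ B  = true
F  ~ A  = true
F  ~ F  = true
F  ~ X  = true
F  ~ Y  = true
F  ~ B  = true
F  ~ C  = true
X  ~ A  = true
X  ~ F  = true
X  ~ X  = true
X  ~ B⋆ = true
Y  ~ F  = true
Y  ~ Y  = true
Y  ~ C⋆ = true
Y  ~ C  = true
B⋆ ~ A  = true
B⋆ ~ X  = true
B⋆ ~ B⋆ = true
B⋆ ~ C⋆ = true
C⋆ ~ Y  = true
C⋆ ~ B⋆ = true
C⋆ ~ C⋆ = true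
C⋆ ~ C  = true
B  ~ A  = true
B  ~ F  = true
C  ~ F  = true
C  ~ Y  = true
C  ~ C⋆ = true
C  ~ C  = true
_  ~ _  = false

forced : Lab → Lab → Maybe Bool
forced B B = nothing
forced B C = nothing
forced C B = nothing
forced l m = just (l ~ m)

consistent : Maybe Bool → Bool → Bool
consistent nothing  _ = true
consistent (just b) a = ⌊ a Bool.≟ b ⌋

consistent-intro : ∀ {mb a} → (∀ {b} → mb ≡ just b → a ≡ b) → T (consistent mb a)
consistent-intro {nothing} _ = tt
consistent-intro {just b}  h = fromWitness (h refl)

data Side : Set where
  B-side C-side neither : Side

side : Lab → Side
side B = B-side
side C = C-side
side _ = neither

chorded₃ : Bool → Bool → Bool → Bool
chorded₃ uv uw vw = not (uv ∧ vw) ∨ uw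

chorded₃-intro : ∀ {uv uw vw} → (uv ≡ true → vw ≡ true → uw ≡ true) → T (chorded₃ uv uw vw)
chorded₃-intro {false}            _ = tt
chorded₃-intro {true} {vw = false} _ = tt
chorded₃-intro {true} {vw = true}  h = from Bool.T-≡ (h refl refl)

chorded₄ : Bool → Bool → Bool → Bool → Bool → Bool → Bool
chorded₄ uv uw ux vw vx wx = not (uv ∧ vw ∧ wx) ∨ uw ∨ vx

chorded₄-intro : ∀ {uv uw ux vw vx wx} →
                 (uv ≡ true → vw ≡ true → wx ≡ true → uw ≡ true ⊎ vx ≡ true) →
                 T (chorded₄ uv uw ux vw vx wx)
chorded₄-intro {false}                          _ = tt
chorded₄-intro {true} {vw = false}              _ = tt
chorded₄-intro {true} {vw = true} {wx = false}  _ = tt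
chorded₄-intro {true} {vw = true} {wx = true}   h with h refl refl refl
... | inj₁ uw = from Bool.T-∨ (inj₁ (from Bool.T-≡ uw))
... | inj₂ vx = from Bool.T-∨ (inj₂ (from Bool.T-≡ vx))

sideOK₃ : Side → Side → Side → Bool → Bool → Bool → Bool
sideOK₃ B-side B-side B-side uv uw vw = chorded₃ uv uw vw
sideOK₃ B-side C-side B-side uv uw vw = chorded₃ uv uw vw
sideOK₃ _      _      _      _  _  _  = true

sideOK₄ : Side → Side → Side → Side → Bool → Bool → Bool → Bool → Bool → Bool → Bool
sideOK₄ C-side B-side B-side C-side uv uw ux vw vx wx = chorded₄ uv uw ux vw vx wx
sideOK₄ _      _      _      _      _  _  _  _  _  _  = true

labelOK₂ : Lab → Lab → Bool → Bool
labelOK₂ l m = consistent (forced l m)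

labelOK₃ : Lab → Lab → Lab → Bool → Bool → Bool → Bool
labelOK₃ l m k = sideOK₃ (side l) (side m) (side k)

labelOK₄ : Lab → Lab → Lab → Lab → Bool → Bool → Bool → Bool → Bool → Bool → Bool
labelOK₄ l m k o = sideOK₄ (side l) (side m) (side k) (side o)

open LocalConstraints labels ∈-labels labelOK₂ labelOK₃ labelOK₄

another : ∀ {t} → 2 ≤ t → (i : Fin t) → ∃[ j ] j ≢ i
another (s≤s (s≤s _)) zero    = suc zero , λ ()
another (s≤s (s≤s _)) (suc _) = zero , λ ()

module Mansion {t n : ℕ} {G : SimpleGraph (Fin n)} (M : IsMansion t G) where
  open IsMansion M

  private
    flip : ∀ {u v b} → adj G v u ≡ b → adj G u v ≡ b
    flip = adj-flip G

  distinct-parts : ∀ {u v p q} → part u ≡ p → part v ≡ q → p ≢ q → u ≢ v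
  distinct-parts u∈ v∈ p≢q refl = p≢q (trans (sym u∈) v∈)

  part-clique : ∀ {u v p} → u ≢ v → part u ≡ p → part v ≡ p → Adj G u v
  part-clique u≢v u∈ v∈ = clique _ _ u≢v (trans u∈ (sym v∈))

  C-clique : ∀ {u v i j} → u ≢ v → part u ≡ pC i → part v ≡ pC j → Adj G u v
  C-clique {i = i} {j} u≢v u∈ v∈ with i ≟ j
  ... | yes refl = part-clique u≢v u∈ v∈
  ... | no i≢j   = C-C _ _ i j i≢j u∈ v∈

  B-same-index⇒adj : ∀ {u v i j} → u ≢ v → part u ≡ pB i → part v ≡ pB j → i ≡ j → Adj G u v
  B-same-index⇒adj u≢v u∈ v∈ refl = part-clique u≢v u∈ v∈

  B-adj⇒same-index : ∀ {u v i j} → part u ≡ pB i → part v ≡ pB j → Adj G u v → i ≡ j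
  B-adj⇒same-index {i = i} {j} u∈ v∈ uv with i ≟ j
  ... | yes i≡j = i≡j
  ... | no i≢j  = contradiction (B-B _ _ i j i≢j u∈ v∈) (Adj⇒¬NonAdj G uv)

  BC-adj⇒same-index : ∀ {u v i j} → part u ≡ pB i → part v ≡ pC j → Adj G u v → i ≡ j
  BC-adj⇒same-index {i = i} {j} u∈ v∈ uv with i ≟ j
  ... | yes i≡j = i≡j
  ... | no i≢j  = contradiction (B-C _ _ i j i≢j u∈ v∈) (Adj⇒¬NonAdj G uv)

  C-neighbourhoods-nested : ∀ {u v i} → part u ≡ pB i → part v ≡ pB i →
    (∀ {c} → part c ≡ pC i → Adj G v c → Adj G u c) ⊎ (∀ {c} → part c ≡ pC i → Adj G u c → Adj G v c)
  C-neighbourhoods-nested {i = i} u∈ v∈ with B-order i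
  ... | _ , _ , _ , _ , onto , _ , _ , antitone with onto _ u∈ | onto _ v∈
  ... | k , refl | l , refl with ≤-total (toℕ k) (toℕ l)
  ... | inj₁ k≤l = inj₁ λ {c} → antitone k l k≤l c
  ... | inj₂ l≤k = inj₂ λ {c} → antitone l k l≤k c

  B-has-C-neighbour : ∀ {v i} → part v ≡ pB i → ∃[ c ] part c ≡ pC i × Adj G v c
  B-has-C-neighbour {i = i} v∈ with B-order i
  ... | r , _ , _ , _ , onto , _ , (c , c∈ , last~c) , antitone with onto _ v∈
  ... | k , refl = c , c∈ , antitone k (fromℕ r) k≤r c c∈ last~c
    where
    k≤r : toℕ k ≤ toℕ (fromℕ r)
    k≤r = subst (toℕ k ≤_) (sym (toℕ-fromℕ r)) (toℕ≤pred[n] k)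

  B-complete-to-C : ∀ i → ∃[ v ] part v ≡ pB i × (∀ {c} → part c ≡ pC i → Adj G v c)
  B-complete-to-C i with B-order i
  ... | _ , b , _ , in-B , _ , complete , _ = b zero , in-B zero , λ {c} → complete c

  data Kind (v : Fin n) : Lab → Set where
    ∈A  : part v ≡ pA → Kind v A
    ∈F  : part v ≡ pF → Kind v F
    ∈X  : part v ≡ pX → Kind v X
    ∈Y  : part v ≡ pY → Kind v Y
    ∈B⋆ : part v ≡ pB jstar → Kind v B⋆
    ∈C⋆ : part v ≡ pC jstar → Kind v C⋆
    ∈B  : ∀ {i} → i ≢ jstar → part v ≡ pB i → Kind v B
    ∈C  : ∀ {i} → i ≢ jstar → part v ≡ pC i → Kind v C

  kind : ∀ v → ∃ (Kind v)
  kind v with part v in v∈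
  ... | pA = A , ∈A v∈
  ... | pF = F , ∈F v∈
  ... | pX = X , ∈X v∈
  ... | pY = Y , ∈Y v∈
  ... | pB i with i ≟ jstar
  ...   | yes refl = B⋆ , ∈B⋆ v∈
  ...   | no i≢j⋆  = B , ∈B i≢j⋆ v∈
  kind v | pC i with i ≟ jstar
  ...   | yes refl = C⋆ , ∈C⋆ v∈
  ...   | no i≢j⋆  = C , ∈C i≢j⋆ v∈

  label : Fin n → Lab
  label = proj₁ ∘ kind

  forced-adj : ∀ {u v l m b} → Kind u l → Kind v m → u ≢ v → forced l m ≡ just b → adj G u v ≡ b
  forced-adj (∈A p)    (∈A q)    u≢v refl = part-clique u≢v p q
  forced-adj (∈A p)    (∈F q)    _   refl = flip (F-A _ _ q p)
  forced-adj (∈A p)    (∈X q)    _   refl = flip (X-A _ _ q p)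
  forced-adj (∈A p)    (∈Y q)    _   refl = flip (Y-A _ _ q p)
  forced-adj (∈A p)    (∈B⋆ q)   _   refl = A-B _ _ _ p q
  forced-adj (∈A p)    (∈C⋆ q)   _   refl = A-C _ _ _ p q
  forced-adj (∈A p)    (∈B _ q)  _   refl = A-B _ _ _ p q
  forced-adj (∈A p)    (∈C _ q)  _   refl = A-C _ _ _ p q
  forced-adj (∈F p)    (∈A q)    _   refl = F-A _ _ p q
  forced-adj (∈F p)    (∈F q)    u≢v refl = part-clique u≢v p q
  forced-adj (∈F p)    (∈X q)    _   refl = F-X _ _ p q
  forced-adj (∈F p)    (∈Y q)    _   refl = F-Y _ _ p q
  forced-adj (∈F p)    (∈B⋆ q)   _   refl = F-Bj _ _ p q
  forced-adj (∈F p)    (∈C⋆ q)   _   refl = F-Cj _ _ p q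
  forced-adj (∈F p)    (∈B i≢j⋆ q)  _   refl = F-B _ _ _ i≢j⋆ p q
  forced-adj (∈F p)    (∈C i≢j⋆ q)  _   refl = F-C _ _ _ i≢j⋆ p q
  forced-adj (∈X p)    (∈A q)    _   refl = X-A _ _ p q
  forced-adj (∈X p)    (∈F q)    _   refl = flip (F-X _ _ q p)
  forced-adj (∈X p)    (∈X q)    u≢v refl = part-clique u≢v p q
  forced-adj (∈X p)    (∈Y q)    _   refl = X-Y _ _ p q
  forced-adj (∈X p)    (∈B⋆ q)   _   refl = X-Bj _ _ p q
  forced-adj (∈X p)    (∈C⋆ q)   _   refl = X-C _ _ _ p q
  forced-adj (∈X p)    (∈B i≢j⋆ q)  _   refl = X-B _ _ _ i≢j⋆ p q
  forced-adj (∈X p)    (∈C _ q)  _   refl = X-C _ _ _ p q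
  forced-adj (∈Y p)    (∈A q)    _   refl = Y-A _ _ p q
  forced-adj (∈Y p)    (∈F q)    _   refl = flip (F-Y _ _ q p)
  forced-adj (∈Y p)    (∈X q)    _   refl = flip (X-Y _ _ q p)
  forced-adj (∈Y p)    (∈Y q)    u≢v refl = part-clique u≢v p q
  forced-adj (∈Y p)    (∈B⋆ q)   _   refl = Y-B _ _ _ p q
  forced-adj (∈Y p)    (∈C⋆ q)   _   refl = Y-C _ _ _ p q
  forced-adj (∈Y p)    (∈B _ q)  _   refl = Y-B _ _ _ p q
  forced-adj (∈Y p)    (∈C _ q)  _   refl = Y-C _ _ _ p q
  forced-adj (∈B⋆ p)   (∈A q)    _   refl = flip (A-B _ _ _ q p)
  forced-adj (∈B⋆ p)   (∈F q)    _   refl = flip (F-Bj _ _ q p)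
  forced-adj (∈B⋆ p)   (∈X q)    _   refl = flip (X-Bj _ _ q p)
  forced-adj (∈B⋆ p)   (∈Y q)    _   refl = flip (Y-B _ _ _ q p)
  forced-adj (∈B⋆ p)   (∈B⋆ q)   u≢v refl = part-clique u≢v p q
  forced-adj (∈B⋆ p)   (∈C⋆ q)   _   refl = Bj-Cj _ _ p q
  forced-adj (∈B⋆ p)   (∈B i≢j⋆ q)  _   refl = B-B _ _ _ _ (≢-sym i≢j⋆) p q
  forced-adj (∈B⋆ p)   (∈C i≢j⋆ q)  _   refl = B-C _ _ _ _ (≢-sym i≢j⋆) p q
  forced-adj (∈C⋆ p)   (∈A q)    _   refl = flip (A-C _ _ _ q p)
  forced-adj (∈C⋆ p)   (∈F q)    _   refl = flip (F-Cj _ _ q p)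
  forced-adj (∈C⋆ p)   (∈X q)    _   refl = flip (X-C _ _ _ q p)
  forced-adj (∈C⋆ p)   (∈Y q)    _   refl = flip (Y-C _ _ _ q p)
  forced-adj (∈C⋆ p)   (∈B⋆ q)   _   refl = flip (Bj-Cj _ _ q p)
  forced-adj (∈C⋆ p)   (∈C⋆ q)   u≢v refl = part-clique u≢v p q
  forced-adj (∈C⋆ p)   (∈B i≢j⋆ q)  _   refl = flip (B-C _ _ _ _ i≢j⋆ q p)
  forced-adj (∈C⋆ p)   (∈C _ q)  u≢v refl = C-clique u≢v p q
  forced-adj (∈B _ p)  (∈A q)    _   refl = flip (A-B _ _ _ q p)
  forced-adj (∈B i≢j⋆ p)  (∈F q)    _   refl = flip (F-B _ _ _ i≢j⋆ q p)
  forced-adj (∈B i≢j⋆ p)  (∈X q)    _   refl = flip (X-B _ _ _ i≢j⋆ q p)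
  forced-adj (∈B _ p)  (∈Y q)    _   refl = flip (Y-B _ _ _ q p)
  forced-adj (∈B i≢j⋆ p)  (∈B⋆ q)   _   refl = B-B _ _ _ _ i≢j⋆ p q
  forced-adj (∈B i≢j⋆ p)  (∈C⋆ q)   _   refl = B-C _ _ _ _ i≢j⋆ p q
  forced-adj (∈B _ _)  (∈B _ _)  _   ()
  forced-adj (∈B _ _)  (∈C _ _)  _   ()
  forced-adj (∈C _ p)  (∈A q)    _   refl = flip (A-C _ _ _ q p)
  forced-adj (∈C i≢j⋆ p)  (∈F q)    _   refl = flip (F-C _ _ _ i≢j⋆ q p)
  forced-adj (∈C _ p)  (∈X q)    _   refl = flip (X-C _ _ _ q p)
  forced-adj (∈C _ p)  (∈Y q)    _   refl = flip (Y-C _ _ _ q p)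
  forced-adj (∈C i≢j⋆ p)  (∈B⋆ q)   _   refl = flip (B-C _ _ _ _ (≢-sym i≢j⋆) q p)
  forced-adj (∈C _ p)  (∈C⋆ q)   u≢v refl = C-clique u≢v p q
  forced-adj (∈C _ _)  (∈B _ _)  _   ()
  forced-adj (∈C _ p)  (∈C _ q)  u≢v refl = C-clique u≢v p q

  data Placement (v : Fin n) : Side → Set where
    onB : ∀ {i} → part v ≡ pB i → Placement v B-side
    onC : ∀ {i} → part v ≡ pC i → Placement v C-side
    off : Placement v neither

  placement : ∀ {v l} → Kind v l → Placement v (side l)
  placement (∈A _)   = off
  placement (∈F _)   = off
  placement (∈X _)   = off
  placement (∈Y _)   = off
  placement (∈B⋆ _)  = off
  placement (∈C⋆ _)  = off
  placement (∈B _ p) = onB p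
  placement (∈C _ p) = onC p

  B-paths-chorded : ∀ {u v w r s q} → Placement u r → Placement v s → Placement w q → u ≢ w →
                    T (sideOK₃ r s q (adj G u v) (adj G u w) (adj G v w))
  B-paths-chorded (onB p) (onB q) (onB o) u≢w = chorded₃-intro λ uv vw →
    B-same-index⇒adj u≢w p o (trans (B-adj⇒same-index p q uv) (B-adj⇒same-index q o vw))
  B-paths-chorded (onB p) (onC q) (onB o) u≢w = chorded₃-intro λ uv vw →
    B-same-index⇒adj u≢w p o (trans (BC-adj⇒same-index p q uv) (sym (BC-adj⇒same-index o q (flip vw))))
  B-paths-chorded off     _       _       _ = tt
  B-paths-chorded (onC _) _       _       _ = tt
  B-paths-chorded (onB _) off     _       _ = tt
  B-paths-chorded (onB _) (onB _) off     _ = tt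
  B-paths-chorded (onB _) (onB _) (onC _) _ = tt
  B-paths-chorded (onB _) (onC _) off     _ = tt
  B-paths-chorded (onB _) (onC _) (onC _) _ = tt

  CBBC-path-chord : ∀ {u v w x i j k l} →
                    part u ≡ pC i → part v ≡ pB j → part w ≡ pB k → part x ≡ pC l →
                    Adj G u v → Adj G v w → Adj G w x → Adj G u w ⊎ Adj G v x
  CBBC-path-chord p q r s uv vw wx
    with BC-adj⇒same-index q p (flip uv) | B-adj⇒same-index q r vw | BC-adj⇒same-index r s wx
  ... | refl | refl | refl with C-neighbourhoods-nested q r
  ... | inj₁ N[w]⊆N[v] = inj₂ (N[w]⊆N[v] s wx)
  ... | inj₂ N[v]⊆N[w] = inj₁ (flip (N[v]⊆N[w] p (flip uv)))

  CBBC-paths-chorded : ∀ {u v w x r s q o} →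
    Placement u r → Placement v s → Placement w q → Placement x o →
    T (sideOK₄ r s q o (adj G u v) (adj G u w) (adj G u x) (adj G v w) (adj G v x) (adj G w x))
  CBBC-paths-chorded {u = u} {x = x} (onC p) (onB q) (onB r) (onC s) =
    chorded₄-intro {ux = adj G u x} (CBBC-path-chord p q r s)
  CBBC-paths-chorded off     _       _       _       = tt
  CBBC-paths-chorded (onB _) _       _       _       = tt
  CBBC-paths-chorded (onC _) off     _       _       = tt
  CBBC-paths-chorded (onC _) (onC _) _       _       = tt
  CBBC-paths-chorded (onC _) (onB _) off     _       = tt
  CBBC-paths-chorded (onC _) (onB _) (onC _) _       = tt
  CBBC-paths-chorded (onC _) (onB _) (onB _) off     = tt
  CBBC-paths-chorded (onC _) (onB _) (onB _) (onB _) = tt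

  respects : Respects G label
  respects = record
    { pairs   = λ { {u} {v} ((u≢v ∷ []) ∷ _) →
                  consistent-intro (forced-adj (proj₂ (kind u)) (proj₂ (kind v)) u≢v) }
    ; triples = λ { {u} {v} {w} ((_ ∷ u≢w ∷ []) ∷ _) →
                  B-paths-chorded (placement′ u) (placement′ v) (placement′ w) u≢w }
    ; quads   = λ {u} {v} {w} {x} _ →
                  CBBC-paths-chorded (placement′ u) (placement′ v) (placement′ w) (placement′ x)
    }
    where
    placement′ : ∀ v → Placement v (side (label v))
    placement′ v = placement (proj₂ (kind v))

  a : Fin n
  a = proj₁ A-ne

  a∈A : part a ≡ pA
  a∈A = proj₂ A-ne

  f : Fin n
  f = proj₁ F-ne

  f∈F : part f ≡ pF
  f∈F = proj₂ F-ne

  c : Fin t → Fin n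
  c i = proj₁ (C-ne i)

  c∈C : ∀ i → part (c i) ≡ pC i
  c∈C i = proj₂ (C-ne i)

  b : Fin t → Fin n
  b i = proj₁ (B-complete-to-C i)

  b∈B : ∀ i → part (b i) ≡ pB i
  b∈B i = proj₁ (proj₂ (B-complete-to-C i))

  b~C : ∀ i {v} → part v ≡ pC i → Adj G (b i) v
  b~C i = proj₂ (proj₂ (B-complete-to-C i))

  no-simplicial : 2 ≤ t → ∀ v → ¬ Simplicial G v
  no-simplicial 2≤t v with part v in v∈
  ... | pA = ¬simplicial G (flip (F-A _ _ f∈F v∈)) (A-B _ _ _ v∈ (b∈B jstar))
                           (distinct-parts f∈F (b∈B jstar) λ ()) (F-Bj _ _ f∈F (b∈B jstar))
  ... | pB i with B-has-C-neighbour v∈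
  ...   | u , u∈ , vu = ¬simplicial G (flip (A-B _ _ _ a∈A v∈)) vu
                                      (distinct-parts a∈A u∈ λ ()) (A-C _ _ _ a∈A u∈)
  no-simplicial 2≤t v | pC i with another 2≤t i
  ...   | j , j≢i = ¬simplicial G (flip (b~C i v∈))
                                  (C-clique (distinct-parts v∈ (c∈C j) λ { refl → j≢i refl }) v∈ (c∈C j))
                                  (distinct-parts (b∈B i) (c∈C j) λ ())
                                  (B-C _ _ _ _ (≢-sym j≢i) (b∈B i) (c∈C j))
  no-simplicial 2≤t v | pF with another 2≤t jstar
  ...   | j , j≢j⋆ = ¬simplicial G (F-A _ _ v∈ a∈A) (F-C _ _ _ j≢j⋆ v∈ (c∈C j))
                                   (distinct-parts a∈A (c∈C j) λ ()) (A-C _ _ _ a∈A (c∈C j))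
  no-simplicial 2≤t v | pX = ¬simplicial G (flip (F-X _ _ f∈F v∈)) (X-Bj _ _ v∈ (b∈B jstar))
                                           (distinct-parts f∈F (b∈B jstar) λ ()) (F-Bj _ _ f∈F (b∈B jstar))
  no-simplicial 2≤t v | pY = ¬simplicial G (flip (F-Y _ _ f∈F v∈)) (Y-C _ _ _ v∈ (c∈C jstar))
                                           (distinct-parts f∈F (c∈C jstar) λ ()) (F-Cj _ _ f∈F (c∈C jstar))

  anticonnected : 2 ≤ t → Anticonnected G
  anticonnected 2≤t = connected-via Ḡ a to-a
    where
    Ḡ : SimpleGraph (Fin n)
    Ḡ = complement _≟_ G

    co-adj : ∀ {u v p q} → part u ≡ p → part v ≡ q → p ≢ q → NonAdj G u v → Adj Ḡ u v
    co-adj u∈ v∈ p≢q uv = complement-adj _≟_ G uv (distinct-parts u∈ v∈ p≢q)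

    C-to-a : ∀ {v i} → part v ≡ pC i → Star (Adj Ḡ) v a
    C-to-a v∈ = co-adj v∈ a∈A (λ ()) (flip (A-C _ _ _ a∈A v∈)) ◅ ε

    to-a : ∀ v → Star (Adj Ḡ) v a
    to-a v with part v in v∈
    ... | pA   = co-adj v∈ (c∈C jstar) (λ ()) (A-C _ _ _ v∈ (c∈C jstar)) ◅ C-to-a (c∈C jstar)
    ... | pB i = let j , j≢i = another 2≤t i in
                 co-adj v∈ (c∈C j) (λ ()) (B-C _ _ _ _ (≢-sym j≢i) v∈ (c∈C j)) ◅ C-to-a (c∈C j)
    ... | pC _ = C-to-a v∈
    ... | pF   = co-adj v∈ (c∈C jstar) (λ ()) (F-Cj _ _ v∈ (c∈C jstar)) ◅ C-to-a (c∈C jstar)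
    ... | pX   = co-adj v∈ (c∈C jstar) (λ ()) (X-C _ _ _ v∈ (c∈C jstar)) ◅ C-to-a (c∈C jstar)
    ... | pY   = co-adj v∈ a∈A (λ ()) (Y-A _ _ v∈ a∈A) ◅ ε

  no-universal : 2 ≤ t → ∀ v → ¬ Universal G v
  no-universal 2≤t v with v ≟ a
  ... | yes refl = anticonnected⇒¬universal _≟_ G (anticonnected 2≤t) (distinct-parts (c∈C jstar) a∈A λ ())
  ... | no v≢a   = anticonnected⇒¬universal _≟_ G (anticonnected 2≤t) (≢-sym v≢a)

  pentagon-vertex : PentV t → Fin n
  pentagon-vertex pa     = a
  pentagon-vertex (pb i) = b i
  pentagon-vertex (pc i) = c i

  pentagon-part : PentV t → Part t
  pentagon-part pa     = pA
  pentagon-part (pb i) = pB i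
  pentagon-part (pc i) = pC i

  part-pentagon-vertex : ∀ x → part (pentagon-vertex x) ≡ pentagon-part x
  part-pentagon-vertex pa     = a∈A
  part-pentagon-vertex (pb i) = b∈B i
  part-pentagon-vertex (pc i) = c∈C i

  pentagon-part-injective : Injective _≡_ _≡_ pentagon-part
  pentagon-part-injective {pa}   {pa}   _    = refl
  pentagon-part-injective {pb _} {pb _} refl = refl
  pentagon-part-injective {pc _} {pc _} refl = refl
  pentagon-part-injective {pa}   {pb _} ()
  pentagon-part-injective {pa}   {pc _} ()
  pentagon-part-injective {pb _} {pa}   ()
  pentagon-part-injective {pb _} {pc _} ()
  pentagon-part-injective {pc _} {pa}   ()
  pentagon-part-injective {pc _} {pb _} ()

  pentagon-vertex-injective : Injective _≡_ _≡_ pentagon-vertex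
  pentagon-vertex-injective {x} {y} same = pentagon-part-injective
    (trans (sym (part-pentagon-vertex x)) (trans (cong part same) (part-pentagon-vertex y)))

  pentagon-adj : ∀ x y → adj (pentagon t) x y ≡ adj G (pentagon-vertex x) (pentagon-vertex y)
  pentagon-adj pa     pa     = sym (adj-irrefl G a)
  pentagon-adj pa     (pb i) = sym (A-B _ _ _ a∈A (b∈B i))
  pentagon-adj pa     (pc i) = sym (A-C _ _ _ a∈A (c∈C i))
  pentagon-adj (pb i) pa     = sym (flip (A-B _ _ _ a∈A (b∈B i)))
  pentagon-adj (pb i) (pb j) with i ≟ j
  ... | yes refl = sym (adj-irrefl G (b i))
  ... | no i≢j   = sym (B-B _ _ _ _ i≢j (b∈B i) (b∈B j))
  pentagon-adj (pb i) (pc j) with i ≟ j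
  ... | yes refl = sym (b~C i (c∈C i))
  ... | no i≢j   = sym (B-C _ _ _ _ i≢j (b∈B i) (c∈C j))
  pentagon-adj (pc i) pa     = sym (flip (A-C _ _ _ a∈A (c∈C i)))
  pentagon-adj (pc i) (pb j) with j ≟ i
  ... | yes refl = sym (flip (b~C j (c∈C j)))
  ... | no j≢i   = sym (flip (B-C _ _ _ _ j≢i (b∈B j) (c∈C i)))
  pentagon-adj (pc i) (pc j) with i ≟ j
  ... | yes refl = sym (adj-irrefl G (c i))
  ... | no i≢j   = sym (C-C _ _ _ _ i≢j (c∈C i) (c∈C j))

  contains-pentagon : ContainsInduced (pentagon t) G
  contains-pentagon = pentagon-vertex , pentagon-vertex-injective , pentagon-adj

proposition5p4 : (t : ℕ) → 3 ≤ t → {n : ℕ} (G : SimpleGraph (Fin n)) → IsMansion t G →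
    Free twoP3 G × Free (cycle 4) G × Free (cycle 6) G × Free (cycle 7) G × Free T0 G
    × ContainsInduced (pentagon t) G
    × Anticonnected G
    × (∀ v → ¬ Simplicial G v)
    × (∀ v → ¬ Universal G v)
proposition5p4 t 3≤t G M =
  free twoP3 refl , free (cycle 4) refl , free (cycle 6) refl , free (cycle 7) refl , free T0 refl ,
  contains-pentagon , anticonnected 2≤t , no-simplicial 2≤t , no-universal 2≤t
  where
  open Mansion M

  2≤t : 2 ≤ t
  2≤t = <⇒≤ 3≤t

  free : ∀ {k} (H : SimpleGraph (Fin k)) → labellable H ≡ false → Free H G
  free H = unlabellable⇒free H respects
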